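{- If $L$ is a finite dismantlable lattice of nullity $k$, then $\operatorname{Dim}(L) \leq k+1$.
   Context: A finite lattice $L$ with $n$ elements is dismantlable if there is a chain of sublattices $L_1 \subset L_2 \subset \cdots \subset L_n = L$ with $|L_i| = i$ for all $i$. The cover graph of a poset $P$ has vertex set $P$ and an edge between $x$ and $y$ whenever one covers the other. The nullity of $P$ is $m - n + c$, where $m$, $n$, $c$ are the numbers of edges, vertices and connected components of the cover graph. The dimension $\operatorname{Dim}(P)$ of a finite poset $P$ is the least number of linear extensions of its order whose intersection is exactly its order. -}

module Defs where

open import Level using (0ℓ)
open import Data.Nat as ℕ using (ℕ; zero; suc; _+_; _≤_)
open import Data.Fin as Fin using (Fin; toℕ)
open import Data.Fin.Properties using (_≟_; any?)
open import Data.Fin.Subset using (Subset; _∈_; _⊆_; ∣_∣)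
open import Data.Product using (Σ; ∃; _×_; _,_; proj₁; proj₂)
open import Data.Sum using (_⊎_)
open import Data.Bool using (Bool; true; false; if_then_else_)
open import Function using (_∘_)
open import Function.Bundles using (_⇔_)
open import Relation.Nullary using (¬_; Dec; yes; no; does)
open import Relation.Nullary.Decidable using (map′; _×-dec_; ¬?)
open import Relation.Binary using (Rel; IsTotalOrder)
open import Relation.Binary.PropositionalEquality using (_≡_; subst)
open import Relation.Binary.Construct.Closure.ReflexiveTransitive using (Star)
open import Relation.Binary.Lattice.Structures using (IsLattice)
open import Algebra.Core using (Op₂)

record FiniteLattice (n : ℕ) : Set₁ where
  field
    _⊑_       : Rel (Fin n) 0ℓ
    _∨_       : Op₂ (Fin n)
    _∧_       : Op₂ (Fin n)
    isLattice : IsLattice _≡_ _⊑_ _∨_ _∧_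
  open IsLattice isLattice public

module _ {n : ℕ} (L : FiniteLattice n) where
  open FiniteLattice L

  _⊏_ : Rel (Fin n) 0ℓ
  x ⊏ y = x ⊑ y × ¬ (x ≡ y)

  _⋖_ : Rel (Fin n) 0ℓ
  x ⋖ y = x ⊏ y × ¬ (∃ λ z → x ⊏ z × z ⊏ y)

  ⊑? : ∀ x y → Dec (x ⊑ y)
  ⊑? x y = map′ to from ((x ∨ y) ≟ y)
    where
    to : x ∨ y ≡ y → x ⊑ y
    to eq = subst (x ⊑_) eq (x≤x∨y x y)
    from : x ⊑ y → x ∨ y ≡ y
    from p = antisym (∨-least p (reflexive _≡_.refl)) (y≤x∨y x y)

  ⊏? : ∀ x y → Dec (x ⊏ y)
  ⊏? x y = ⊑? x y ×-dec ¬? (x ≟ y)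

  ⋖? : ∀ x y → Dec (x ⋖ y)
  ⋖? x y = ⊏? x y ×-dec ¬? (any? λ z → ⊏? x z ×-dec ⊏? z y)

  sumFin : ∀ {k} → (Fin k → ℕ) → ℕ
  sumFin {zero}  f = 0
  sumFin {suc k} f = f Fin.zero + sumFin (f ∘ Fin.suc)

  coverEdges : ℕ
  coverEdges = sumFin λ x → sumFin λ y → if does (⋖? x y) then 1 else 0

  Adj : Rel (Fin n) 0ℓ
  Adj x y = x ⋖ y ⊎ y ⋖ x

  Connected : Rel (Fin n) 0ℓ
  Connected = Star Adj

  -- c is the number of connected components of the cover graph:
  -- there is a surjective labelling of vertices by Fin c whose fibres are
  -- exactly the connected components.
  HasComponents : ℕ → Set
  HasComponents c = Σ (Fin n → Fin c) λ comp →
    (∀ i → ∃ λ x → comp x ≡ i) ×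
    (∀ x y → (comp x ≡ comp y) ⇔ Connected x y)

  -- nullity m - n + c = k of the cover graph
  HasNullity : ℕ → Set
  HasNullity k = ∃ λ c → HasComponents c × (coverEdges + c ≡ k + n)

  -- Dismantlable: chain of sublattices L_1 ⊂ ... ⊂ L_n = L with |L_i| = i
  -- (L_{i+1} is represented by S i for i : Fin n).
  IsSublattice : Subset n → Set
  IsSublattice S = ∀ x y → x ∈ S → y ∈ S → (x ∨ y) ∈ S × (x ∧ y) ∈ S

  Dismantlable : Set
  Dismantlable = Σ (Fin n → Subset n) λ S →
    (∀ i → ∣ S i ∣ ≡ suc (toℕ i)) ×
    (∀ i j → i Fin.≤ j → S i ⊆ S j) ×
    (∀ i → IsSublattice (S i)) ×
    (∀ i → toℕ i ≡ ℕ.pred n → ∀ x → x ∈ S i)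

  IsLinearExtension : Rel (Fin n) 0ℓ → Set
  IsLinearExtension R = IsTotalOrder _≡_ R × (∀ x y → x ⊑ y → R x y)

  Realizer : ℕ → Set₁
  Realizer d = Σ (Fin d → Rel (Fin n) 0ℓ) λ Rs →
    (∀ i → IsLinearExtension (Rs i)) ×
    (∀ x y → x ⊑ y ⇔ (∀ i → Rs i x y))

  -- Dim(L) ≤ d  (Dim is the least size of a realizer)
  DimAtMost : ℕ → Set₁
  DimAtMost d = ∃ λ d′ → d′ ≤ d × Realizer d′

module Submission where

-- Choose for every non-bottom x a lower cover parent x. These n - 1 cover edges form a
-- spanning tree rooted at the bottom, and the paths from its leaves down to the root are
-- chains covering L. For each chain C there is a linear extension in which every element
-- of C lies above all elements it is not below (order first by the number of elements of
-- C below, then by rank); these extensions realize L, so Dim(L) is at most the number of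
-- leaves. Counting upper covers, an element has at least as many as it has tree children,
-- and at least one if it is a leaf other than the top; with a unique top and bottom this
-- gives #leaves ≤ m - n + 2 ≤ m - n + c + 1 = k + 1.

open import Level using (Level; 0ℓ)
open import Data.Bool using (if_then_else_)
open import Data.Nat
  using (ℕ; zero; suc; _+_; _∸_; _≤_; _<_; _≤′_; z≤n; s≤s; ≤′-refl; ≤′-step)
open import Data.Nat.Properties
open import Data.Fin as Fin using (Fin; toℕ; fromℕ<)
open import Data.Fin.Properties as Finₚ using (any?; ¬Fin0; toℕ-fromℕ<)
open import Data.Product using (∃; ∃₂; _×_; _,_; proj₁; proj₂)
open import Data.Product.Relation.Binary.Lex.NonStrict using (×-Lex; ×-isTotalOrder)
open import Data.Sum using (_⊎_; inj₁; inj₂)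
open import Data.List using (List; length; filter; lookup; tabulate; allFin)
open import Data.List.Membership.Propositional.Properties using (∈-filter⁺; ∈-allFin)
open import Data.List.Relation.Unary.Any using (index)
open import Data.List.Relation.Unary.Any.Properties using (lookup-index)
open import Function using (id; _∘_; _on_; flip)
open import Function.Bundles using (mk⇔)
open import Data.Nat.Induction using (<-wellFounded)
open import Induction.WellFounded using (WellFounded; Acc; acc; module Subrelation)
import Relation.Binary.Construct.On as On
open import Relation.Binary using (Rel; IsTotalOrder)
open import Relation.Binary.PropositionalEquality
open import Relation.Nullary using (¬_; Dec; yes; no; does; contradiction)
open import Relation.Nullary.Decidable using (_×-dec_; ¬?)
open import Relation.Unary using (Pred; Decidable; _⊆_)
open import Algebra.Properties.CommutativeMonoid.Sum +-0-commutativeMonoid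
  using (sum; sum-syntax; ∑-comm; ∑-distrib-+; sum-cong-≗)
open import Algebra.Properties.CommutativeSemigroup +-commutativeSemigroup using (x∙yz≈yx∙z)

import Defs as D
open import Defs
  using (FiniteLattice; Dismantlable; HasNullity; DimAtMost; Realizer; IsLinearExtension)

private
  variable
    a b p q ℓ ℓ₁ ℓ₂ : Level
    A : Set a
    k : ℕ

-- Counting in Fin k

𝟙 : {P : Set p} → Dec P → ℕ
𝟙 P? = if does P? then 1 else 0

𝟙-yes : {P : Set p} (P? : Dec P) → P → 𝟙 P? ≡ 1
𝟙-yes (yes _)  _ = refl
𝟙-yes (no ¬px) px = contradiction px ¬px

𝟙-no : {P : Set p} (P? : Dec P) → ¬ P → 𝟙 P? ≡ 0
𝟙-no (yes px) ¬px = contradiction px ¬px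
𝟙-no (no _)   _   = refl

𝟙-mono : {P : Set p} {Q : Set q} (P? : Dec P) (Q? : Dec Q) → (P → Q) → 𝟙 P? ≤ 𝟙 Q?
𝟙-mono (yes px) Q? P⇒Q = ≤-reflexive (sym (𝟙-yes Q? (P⇒Q px)))
𝟙-mono (no _)   Q? P⇒Q = z≤n

sum-mono-≤ : {f g : Fin k → ℕ} → (∀ i → f i ≤ g i) → sum f ≤ sum g
sum-mono-≤ {zero}  f≤g = z≤n
sum-mono-≤ {suc k} f≤g = +-mono-≤ (f≤g Fin.zero) (sum-mono-≤ (f≤g ∘ Fin.suc))

sum-mono-< : {f g : Fin k → ℕ} → (∀ i → f i ≤ g i) → ∀ j → f j < g j →
             sum f < sum g
sum-mono-< {suc k} f≤g Fin.zero    fj<gj = +-mono-<-≤ fj<gj (sum-mono-≤ (f≤g ∘ Fin.suc))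
sum-mono-< {suc k} f≤g (Fin.suc j) fj<gj =
  +-mono-≤-< (f≤g Fin.zero) (sum-mono-< (f≤g ∘ Fin.suc) j fj<gj)

count : {P : Pred (Fin k) p} → Decidable P → ℕ
count {k} P? = ∑[ i < k ] 𝟙 (P? i)

count-≤ : {P : Pred (Fin k) p} (P? : Decidable P) → count P? ≤ k
count-≤ {zero}  P? = z≤n
count-≤ {suc k} P? with P? Fin.zero
... | yes _ = s≤s (count-≤ (P? ∘ Fin.suc))
... | no _  = m≤n⇒m≤1+n (count-≤ (P? ∘ Fin.suc))

count-∅ : {P : Pred (Fin k) p} (P? : Decidable P) → (∀ x → ¬ P x) → count P? ≡ 0
count-∅ {zero}  P? none = refl
count-∅ {suc k} P? none = cong₂ _+_ (𝟙-no (P? Fin.zero) (none Fin.zero))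
                                    (count-∅ (P? ∘ Fin.suc) (none ∘ Fin.suc))

count>0 : {P : Pred (Fin k) p} (P? : Decidable P) → ∀ {x} → P x → 0 < count P?
count>0 P? {Fin.zero}  px =
  ≤-trans (≤-reflexive (sym (𝟙-yes (P? Fin.zero) px))) (m≤m+n _ _)
count>0 P? {Fin.suc x} px = ≤-trans (count>0 (P? ∘ Fin.suc) px) (m≤n+m _ _)

count-≤1 : {P : Pred (Fin k) p} (P? : Decidable P) →
           (∀ {x y} → P x → P y → x ≡ y) → count P? ≤ 1
count-≤1 {zero}  P? unique = z≤n
count-≤1 {suc k} P? unique with P? Fin.zero
... | yes p0 =
  ≤-reflexive (cong suc (count-∅ (P? ∘ Fin.suc) λ x px → Finₚ.0≢1+n (unique p0 px)))
... | no _   = count-≤1 (P? ∘ Fin.suc) λ px py → Finₚ.suc-injective (unique px py)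

count+count∁ : {P : Pred (Fin k) p} (P? : Decidable P) → count P? + count (¬? ∘ P?) ≡ k
count+count∁ {zero}  P? = refl
count+count∁ {suc k} P? with P? Fin.zero
... | yes _ = cong suc (count+count∁ (P? ∘ Fin.suc))
... | no _  = trans (+-suc _ _) (cong suc (count+count∁ (P? ∘ Fin.suc)))

module _ {P : Pred (Fin k) p} {Q : Pred (Fin k) q} (P? : Decidable P) (Q? : Decidable Q) where

  count-mono : P ⊆ Q → count P? ≤ count Q?
  count-mono P⊆Q = sum-mono-≤ λ i → 𝟙-mono (P? i) (Q? i) P⊆Q

  count-mono-< : P ⊆ Q → ∀ {x} → Q x → ¬ P x → count P? < count Q?
  count-mono-< P⊆Q {x} qx ¬px = sum-mono-< (λ i → 𝟙-mono (P? i) (Q? i) P⊆Q) x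
    (subst₂ _<_ (sym (𝟙-no (P? x) ¬px)) (sym (𝟙-yes (Q? x) qx)) (s≤s z≤n))

count-≡ : (a : Fin k) → count (a Finₚ.≟_) ≡ 1
count-≡ a = ≤-antisym (count-≤1 (a Finₚ.≟_) λ a≡x a≡y → trans (sym a≡x) a≡y)
                      (count>0 (a Finₚ.≟_) refl)

count-×-≡ : {P : Set p} (P? : Dec P) (a : Fin k) →
            count (λ y → P? ×-dec (a Finₚ.≟ y)) ≡ 𝟙 P?
count-×-≡ (yes _)  a = count-≡ a
count-×-≡ (no ¬p) a = count-∅ (λ y → no ¬p ×-dec (a Finₚ.≟ y)) λ _ → ¬p ∘ proj₁

length-filter-tabulate : {P : Pred A p} (P? : Decidable P) (f : Fin k → A) →
                         length (filter P? (tabulate f)) ≡ count (P? ∘ f)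
length-filter-tabulate {k = zero}  P? f = refl
length-filter-tabulate {k = suc k} P? f with P? (f Fin.zero)
... | yes _ = cong suc (length-filter-tabulate P? (f ∘ Fin.suc))
... | no _  = length-filter-tabulate P? (f ∘ Fin.suc)

-- Orders by a numeric key

isTotalOrder-onInjective : {B : Set b} {_≈_ : Rel B ℓ₁} {_≤_ : Rel B ℓ₂}
                           (f : A → B) → (∀ {x y} → f x ≈ f y → x ≡ y) →
                           IsTotalOrder _≈_ _≤_ → IsTotalOrder _≡_ (_≤_ on f)
isTotalOrder-onInjective f injective tot = record
  { isPartialOrder = record
    { isPreorder = record
      { isEquivalence = isEquivalence
      ; reflexive     = λ { refl → T.refl }
      ; trans         = T.trans
      }
    ; antisym = λ x≤y y≤x → injective (T.antisym x≤y y≤x)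
    }
  ; total = λ x y → T.total (f x) (f y)
  }
  where module T = IsTotalOrder tot

byKey : (A → ℕ) → Rel A ℓ → Rel A ℓ
byKey K R = ×-Lex _≡_ _≤_ R on (λ x → K x , x)

module _ {R : Rel A ℓ} (K : A → ℕ) where

  byKey-isTotalOrder : IsTotalOrder _≡_ R → IsTotalOrder _≡_ (byKey K R)
  byKey-isTotalOrder R-total =
    isTotalOrder-onInjective (λ x → K x , x) proj₂
      (×-isTotalOrder _≟_ ≤-isTotalOrder R-total)

  byKey-intro : ∀ {x y} → K x ≤ K y → (K x ≡ K y → R x y) → byKey K R x y
  byKey-intro {x} {y} Kx≤Ky tie with K x ≟ K y
  ... | yes Kx≡Ky = inj₂ (Kx≡Ky , tie Kx≡Ky)
  ... | no  Kx≢Ky = inj₁ (Kx≤Ky , Kx≢Ky)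

  byKey-key : ∀ {x y} → byKey K R x y → K x ≤ K y
  byKey-key (inj₁ (Kx≤Ky , _)) = Kx≤Ky
  byKey-key (inj₂ (Kx≡Ky , _)) = ≤-reflexive Kx≡Ky

module _ {n : ℕ} (L : FiniteLattice n) where
  open FiniteLattice L
    using (_⊑_; _∨_; _∧_; x≤x∨y; y≤x∨y; x∧y≤x; x∧y≤y; antisym)
    renaming (refl to ⊑-refl; trans to ⊑-trans)

  _⊑?_ : ∀ x y → Dec (x ⊑ y)
  _⊑?_ = D.⊑? L

  _⊏_ : Rel (Fin n) 0ℓ
  _⊏_ = D._⊏_ L

  _⊐_ : Rel (Fin n) 0ℓ
  _⊐_ = flip _⊏_

  _⊏?_ : ∀ x y → Dec (x ⊏ y)
  _⊏?_ = D.⊏? L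

  _⋖_ : Rel (Fin n) 0ℓ
  _⋖_ = D._⋖_ L

  _⋖?_ : ∀ x y → Dec (x ⋖ y)
  _⋖?_ = D.⋖? L

  rank : Fin n → ℕ
  rank y = count (_⊑? y)

  rank-mono : ∀ {x y} → x ⊑ y → rank x ≤ rank y
  rank-mono x⊑y = count-mono (_⊑? _) (_⊑? _) λ z⊑x → ⊑-trans z⊑x x⊑y

  rank-strict : ∀ {x y} → x ⊏ y → rank x < rank y
  rank-strict (x⊑y , x≢y) =
    count-mono-< (_⊑? _) (_⊑? _) (λ z⊑x → ⊑-trans z⊑x x⊑y) ⊑-refl λ y⊑x → x≢y (antisym x⊑y y⊑x)

  rank≤n : ∀ y → rank y ≤ n
  rank≤n y = count-≤ (_⊑? y)

  rank>0 : ∀ y → 0 < rank y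
  rank>0 y = count>0 (_⊑? y) ⊑-refl

  ⊑∧rank≡⇒≡ : ∀ {x y} → x ⊑ y → rank x ≡ rank y → x ≡ y
  ⊑∧rank≡⇒≡ {x} {y} x⊑y rank≡ with x Finₚ.≟ y
  ... | yes x≡y = x≡y
  ... | no  x≢y = contradiction rank≡ (<⇒≢ (rank-strict (x⊑y , x≢y)))

  ⊏-wellFounded : WellFounded _⊏_
  ⊏-wellFounded = Subrelation.wellFounded rank-strict (On.wellFounded rank <-wellFounded)

  ⊐-wellFounded : WellFounded _⊐_
  ⊐-wellFounded = Subrelation.wellFounded (λ y⊏x → ∸-monoʳ-< (rank-strict y⊏x) (rank≤n _))
                                          (On.wellFounded (λ x → n ∸ rank x) <-wellFounded)

  -- Linear extensions from a chain cover

  byKey-isLinearExtension : ∀ {K R} → IsTotalOrder _≡_ R →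
    (∀ {x y} → x ⊑ y → K x ≤ K y) → (∀ {x y} → x ⊑ y → K x ≡ K y → R x y) →
    IsLinearExtension L (byKey K R)
  byKey-isLinearExtension {K} {R} R-total mono tie =
    byKey-isTotalOrder K R-total , λ _ _ x⊑y → byKey-intro {R = R} K (mono x⊑y) (tie x⊑y)

  rankOrder : Rel (Fin n) 0ℓ
  rankOrder = byKey rank Fin._≤_

  rankOrder-isLinearExtension : IsLinearExtension L rankOrder
  rankOrder-isLinearExtension = byKey-isLinearExtension Finₚ.≤-isTotalOrder rank-mono
    λ x⊑y rank≡ → Finₚ.≤-reflexive (⊑∧rank≡⇒≡ x⊑y rank≡)

  IsChain : ∀ {m} → (Fin m → Fin n) → Set
  IsChain c = ∀ i j → c i ⊑ c j ⊎ c j ⊑ c i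

  module _ {m : ℕ} (c : Fin m → Fin n) where

    chainBelow : Fin n → ℕ
    chainBelow y = count λ j → c j ⊑? y

    chainOrder : Rel (Fin n) 0ℓ
    chainOrder = byKey chainBelow rankOrder

    chainOrder-isLinearExtension : IsLinearExtension L chainOrder
    chainOrder-isLinearExtension =
      byKey-isLinearExtension (proj₁ rankOrder-isLinearExtension)
        (λ {x} {y} x⊑y → count-mono (λ j → c j ⊑? x) (λ j → c j ⊑? y) λ cj⊑x → ⊑-trans cj⊑x x⊑y)
        (λ x⊑y _ → proj₂ rankOrder-isLinearExtension _ _ x⊑y)

    chainOrder-lifts : IsChain c → ∀ {j y} → ¬ c j ⊑ y → ¬ chainOrder (c j) y
    chainOrder-lifts chain {j} {y} cj⋢y cj≤y =
      <⇒≱ (count-mono-< (λ i → c i ⊑? y) (λ i → c i ⊑? c j) ci⊑y⇒ci⊑cj ⊑-refl cj⋢y)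
          (byKey-key {R = rankOrder} chainBelow cj≤y)
      where
      ci⊑y⇒ci⊑cj : ∀ {i} → c i ⊑ y → c i ⊑ c j
      ci⊑y⇒ci⊑cj {i} ci⊑y with chain i j
      ... | inj₁ ci⊑cj = ci⊑cj
      ... | inj₂ cj⊑ci = contradiction (⊑-trans cj⊑ci ci⊑y) cj⋢y

  chainCover⇒realizer : ∀ {d m} (c : Fin d → Fin m → Fin n) → (∀ i → IsChain (c i)) →
                        (∀ x → ∃₂ λ i j → c i j ≡ x) → Realizer L d
  chainCover⇒realizer c chains covers =
    (λ i → chainOrder (c i)) ,
    (λ i → chainOrder-isLinearExtension (c i)) ,
    λ x y → mk⇔ (λ x⊑y i → proj₂ (chainOrder-isLinearExtension (c i)) x y x⊑y) (separated x y)
    where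
    separated : ∀ x y → (∀ i → chainOrder (c i) x y) → x ⊑ y
    separated x y below-everywhere with x ⊑? y | covers x
    ... | yes x⊑y | _            = x⊑y
    ... | no  x⋢y | i , j , refl =
      contradiction (below-everywhere i) (chainOrder-lifts (c i) (chains i) x⋢y)

  -- A spanning tree of lower covers

  upperCover : ∀ {x z} → x ⊏ z → ∃ (x ⋖_)
  upperCover {x} {z} x⊏z = go (⊏-wellFounded z) x⊏z
    where
    go : ∀ {z} → Acc _⊏_ z → x ⊏ z → ∃ (x ⋖_)
    go {z} (acc smaller) x⊏z with any? (λ u → x ⊏? u ×-dec u ⊏? z)
    ... | yes (u , x⊏u , u⊏z) = go (smaller u⊏z) x⊏u
    ... | no  nothing-between = z , x⊏z , nothing-between

  lowerCover : ∀ {x z} → z ⊏ x → ∃ (_⋖ x)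
  lowerCover {x} {z} z⊏x = go (⊐-wellFounded z) z⊏x
    where
    go : ∀ {z} → Acc _⊐_ z → z ⊏ x → ∃ (_⋖ x)
    go {z} (acc larger) z⊏x with any? (λ u → z ⊏? u ×-dec u ⊏? x)
    ... | yes (u , z⊏u , u⊏x) = go (larger z⊏u) u⊏x
    ... | no  nothing-between = z , z⊏x , nothing-between

  Maximal : Pred (Fin n) 0ℓ
  Maximal x = ¬ ∃ (x ⊏_)

  maximal? : Decidable Maximal
  maximal? x = ¬? (any? (x ⊏?_))

  NonMinimal : Pred (Fin n) 0ℓ
  NonMinimal x = ∃ (_⊏ x)

  nonMinimal? : Decidable NonMinimal
  nonMinimal? x = any? (_⊏? x)

  maximal-unique : ∀ {x y} → Maximal x → Maximal y → x ≡ y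
  maximal-unique {x} {y} x-max y-max with x Finₚ.≟ x ∨ y | y Finₚ.≟ x ∨ y
  ... | yes x≡x∨y | yes y≡x∨y = trans x≡x∨y (sym y≡x∨y)
  ... | no  x≢x∨y | _         = contradiction (x ∨ y , x≤x∨y x y , x≢x∨y) x-max
  ... | _         | no  y≢x∨y = contradiction (x ∨ y , y≤x∨y x y , y≢x∨y) y-max

  minimal-unique : ∀ {x y} → ¬ NonMinimal x → ¬ NonMinimal y → x ≡ y
  minimal-unique {x} {y} x-min y-min with x ∧ y Finₚ.≟ x | x ∧ y Finₚ.≟ y
  ... | yes x∧y≡x | yes x∧y≡y = trans (sym x∧y≡x) x∧y≡y
  ... | no  x∧y≢x | _         = contradiction (x ∧ y , x∧y≤x x y , x∧y≢x) x-min
  ... | _         | no  x∧y≢y = contradiction (x ∧ y , x∧y≤y x y , x∧y≢y) y-min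

  -- A minimal element is its own parent.
  parent : Fin n → Fin n
  parent x with nonMinimal? x
  ... | yes (_ , z⊏x) = proj₁ (lowerCover z⊏x)
  ... | no  _         = x

  parent-⋖ : ∀ {x} → NonMinimal x → parent x ⋖ x
  parent-⋖ {x} x-nonMin with nonMinimal? x
  ... | yes (_ , z⊏x) = proj₂ (lowerCover z⊏x)
  ... | no  x-min     = contradiction x-nonMin x-min

  parent-⊑ : ∀ x → parent x ⊑ x
  parent-⊑ x with nonMinimal? x
  ... | yes (_ , z⊏x) = proj₁ (proj₁ (proj₂ (lowerCover z⊏x)))
  ... | no  _         = ⊑-refl

  Child : Fin n → Pred (Fin n) 0ℓ
  Child y x = NonMinimal x × parent x ≡ y

  child? : ∀ y → Decidable (Child y)
  child? y x = nonMinimal? x ×-dec parent x Finₚ.≟ y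

  Leaf : Pred (Fin n) 0ℓ
  Leaf y = ¬ ∃ (Child y)

  leaf? : Decidable Leaf
  leaf? y = ¬? (any? (child? y))

  parent^ : ℕ → Fin n → Fin n
  parent^ zero    x = x
  parent^ (suc j) x = parent (parent^ j x)

  parent^-antitone : ∀ {i j} x → i ≤′ j → parent^ j x ⊑ parent^ i x
  parent^-antitone x ≤′-refl        = ⊑-refl
  parent^-antitone x (≤′-step i≤′j) = ⊑-trans (parent-⊑ _) (parent^-antitone x i≤′j)

  branch : Fin n → Fin n → Fin n
  branch ℓ j = parent^ (toℕ j) ℓ

  branch-isChain : ∀ ℓ → IsChain (branch ℓ)
  branch-isChain ℓ i j with ≤-total (toℕ i) (toℕ j)
  ... | inj₁ i≤j = inj₂ (parent^-antitone ℓ (≤⇒≤′ i≤j))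
  ... | inj₂ j≤i = inj₁ (parent^-antitone ℓ (≤⇒≤′ j≤i))

  leafAbove : ∀ x → ∃ λ ℓ → Leaf ℓ × ∃ λ j → parent^ j ℓ ≡ x × rank x + j ≤ rank ℓ
  leafAbove x = go x (⊐-wellFounded x)
    where
    go : ∀ x → Acc _⊐_ x → ∃ λ ℓ → Leaf ℓ × ∃ λ j → parent^ j ℓ ≡ x × rank x + j ≤ rank ℓ
    go x (acc larger) with any? (child? x)
    ... | no  x-leaf = x , x-leaf , 0 , refl , ≤-reflexive (+-identityʳ _)
    ... | yes (x′ , x′-nonMin , parent≡x) =
      let x⊏x′ = subst (_⊏ x′) parent≡x (proj₁ (parent-⋖ x′-nonMin))
          ℓ , ℓ-leaf , j , parent^j≡x′ , rank-bound = go x′ (larger x⊏x′)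
      in ℓ , ℓ-leaf , suc j , trans (cong parent parent^j≡x′) parent≡x ,
         ≤-trans (≤-reflexive (+-suc (rank x) j))
                 (≤-trans (+-monoˡ-≤ j (rank-strict x⊏x′)) rank-bound)

  onBranch : ∀ x → ∃ λ ℓ → Leaf ℓ × ∃ λ j → branch ℓ j ≡ x
  onBranch x =
    let ℓ , ℓ-leaf , j , parent^j≡x , rank-bound = leafAbove x
        j<n = ≤-trans (+-monoˡ-≤ j (rank>0 x)) (≤-trans rank-bound (rank≤n ℓ))
    in ℓ , ℓ-leaf , fromℕ< j<n ,
       trans (cong (λ i → parent^ i ℓ) (toℕ-fromℕ< j<n)) parent^j≡x

  leaves : List (Fin n)
  leaves = filter leaf? (allFin n)

  length-leaves : length leaves ≡ count leaf?
  length-leaves = length-filter-tabulate leaf? id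

  leafBranches : Fin (length leaves) → Fin n → Fin n
  leafBranches i = branch (lookup leaves i)

  leafBranches-cover : ∀ x → ∃₂ λ i j → leafBranches i j ≡ x
  leafBranches-cover x =
    let ℓ , ℓ-leaf , j , branch≡x = onBranch x
        ℓ∈leaves = ∈-filter⁺ leaf? (∈-allFin ℓ) ℓ-leaf
    in index ℓ∈leaves , j , subst (λ ℓ′ → branch ℓ′ j ≡ x) (lookup-index ℓ∈leaves) branch≡x

  -- Counting leaves

  upperCovers : Fin n → ℕ
  upperCovers y = count (y ⋖?_)

  children : Fin n → ℕ
  children y = count (child? y)

  sumFin≡sum : ∀ {k} (f : Fin k → ℕ) → D.sumFin L f ≡ sum f
  sumFin≡sum {zero}  f = refl
  sumFin≡sum {suc k} f = cong (f Fin.zero +_) (sumFin≡sum (f ∘ Fin.suc))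

  coverEdges≡∑upperCovers : D.coverEdges L ≡ ∑[ y < n ] upperCovers y
  coverEdges≡∑upperCovers = trans (sumFin≡sum λ y → D.sumFin L (𝟙 ∘ (y ⋖?_)))
                                  (sum-cong-≗ λ y → sumFin≡sum (𝟙 ∘ (y ⋖?_)))

  ∑children≡#nonMinimal : ∑[ y < n ] children y ≡ count nonMinimal?
  ∑children≡#nonMinimal = begin
    ∑[ y < n ] ∑[ x < n ] 𝟙 (child? y x) ≡⟨ ∑-comm (λ y x → 𝟙 (child? y x)) ⟩
    ∑[ x < n ] ∑[ y < n ] 𝟙 (child? y x) ≡⟨ sum-cong-≗ (λ x → count-×-≡ (nonMinimal? x) (parent x)) ⟩
    count nonMinimal?                     ∎
    where open ≡-Reasoning

  upperCovers+maximal>0 : ∀ y → 0 < upperCovers y + 𝟙 (maximal? y)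
  upperCovers+maximal>0 y with any? (y ⊏?_)
  ... | yes (_ , y⊏z) = ≤-trans (count>0 (y ⋖?_) (proj₂ (upperCover y⊏z))) (m≤m+n _ _)
  ... | no  _         = m≤n+m 1 _

  children+leaf≤upperCovers+maximal :
    ∀ y → children y + 𝟙 (leaf? y) ≤ upperCovers y + 𝟙 (maximal? y)
  children+leaf≤upperCovers+maximal y with any? (child? y)
  ... | yes _ = begin
    children y + 0                 ≡⟨ +-identityʳ _ ⟩
    children y                     ≤⟨ count-mono (child? y) (y ⋖?_) child⇒cover ⟩
    upperCovers y                  ≤⟨ m≤m+n _ _ ⟩
    upperCovers y + 𝟙 (maximal? y) ∎
    where
    open ≤-Reasoning
    child⇒cover : ∀ {x} → Child y x → y ⋖ x
    child⇒cover {x} (x-nonMin , parent≡y) = subst (_⋖ x) parent≡y (parent-⋖ x-nonMin)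
  ... | no y-leaf rewrite count-∅ (child? y) (λ x child → y-leaf (x , child)) =
    upperCovers+maximal>0 y

  ∑children+#leaves≤∑upperCovers+#maximal :
    ∑[ y < n ] children y + count leaf? ≤ ∑[ y < n ] upperCovers y + count maximal?
  ∑children+#leaves≤∑upperCovers+#maximal = begin
    ∑[ y < n ] children y + count leaf?         ≡⟨ ∑-distrib-+ children (𝟙 ∘ leaf?) ⟨
    ∑[ y < n ] (children y + 𝟙 (leaf? y))       ≤⟨ sum-mono-≤ children+leaf≤upperCovers+maximal ⟩
    ∑[ y < n ] (upperCovers y + 𝟙 (maximal? y)) ≡⟨ ∑-distrib-+ upperCovers (𝟙 ∘ maximal?) ⟩
    ∑[ y < n ] upperCovers y + count maximal?   ∎
    where open ≤-Reasoning

  #leaves+n≤coverEdges+2 : count leaf? + n ≤ D.coverEdges L + 2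
  #leaves+n≤coverEdges+2 = begin
    #leaves + n                                  ≡⟨ cong (#leaves +_) (count+count∁ nonMinimal?) ⟨
    #leaves + (count nonMinimal? + #minimal)     ≡⟨ x∙yz≈yx∙z #leaves (count nonMinimal?) #minimal ⟩
    count nonMinimal? + #leaves + #minimal       ≡⟨ cong (λ e → e + #leaves + #minimal) ∑children≡#nonMinimal ⟨
    ∑[ y < n ] children y + #leaves + #minimal   ≤⟨ +-monoˡ-≤ #minimal ∑children+#leaves≤∑upperCovers+#maximal ⟩
    ∑[ y < n ] upperCovers y + #maximal + #minimal ≡⟨ +-assoc _ #maximal #minimal ⟩
    ∑[ y < n ] upperCovers y + (#maximal + #minimal) ≤⟨ +-monoʳ-≤ _ (+-mono-≤ #maximal≤1 #minimal≤1) ⟩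
    ∑[ y < n ] upperCovers y + 2                 ≡⟨ cong (_+ 2) coverEdges≡∑upperCovers ⟨
    D.coverEdges L + 2                           ∎
    where
    open ≤-Reasoning
    #leaves #maximal #minimal : ℕ
    #leaves  = count leaf?
    #maximal = count maximal?
    #minimal = count (¬? ∘ nonMinimal?)
    #maximal≤1 : #maximal ≤ 1
    #maximal≤1 = count-≤1 maximal? maximal-unique
    #minimal≤1 : #minimal ≤ 1
    #minimal≤1 = count-≤1 (¬? ∘ nonMinimal?) minimal-unique

  #leaves≤1+nullity : ∀ {k} → HasNullity L k → count leaf? ≤ suc k
  #leaves≤1+nullity (zero , (component , _) , _) =
    subst (_≤ _) (sym (count-∅ leaf? λ x _ → ¬Fin0 (component x))) z≤n
  #leaves≤1+nullity {k} (suc c , _ , edges+c≡k+n) = +-cancelʳ-≤ n (count leaf?) (suc k) (begin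
    count leaf? + n              ≤⟨ #leaves+n≤coverEdges+2 ⟩
    D.coverEdges L + 2           ≤⟨ +-monoʳ-≤ (D.coverEdges L) (s≤s (m≤n+m 1 c)) ⟩
    D.coverEdges L + (suc c + 1) ≡⟨ +-assoc (D.coverEdges L) (suc c) 1 ⟨
    D.coverEdges L + suc c + 1   ≡⟨ cong (_+ 1) edges+c≡k+n ⟩
    k + n + 1                    ≡⟨ +-comm (k + n) 1 ⟩
    suc k + n                    ∎)
    where open ≤-Reasoning

mainTheorem10 : ∀ (n : ℕ) (L : FiniteLattice n) (k : ℕ) →
    Dismantlable L → HasNullity L k → DimAtMost L (suc k)
mainTheorem10 n L k _ nullity =
  length (leaves L) ,
  subst (_≤ suc k) (sym (length-leaves L)) (#leaves≤1+nullity L nullity) ,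
  chainCover⇒realizer L (leafBranches L) (branch-isChain L ∘ lookup (leaves L)) (leafBranches-cover L)
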